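{- Let $f:\{0,1\}^n\to\{0,1\}$ be a symmetric Boolean function with value vector $R$ having $B$ blocks with minimum indices $0=\alpha_1<\alpha_2<\cdots<\alpha_B$. Fix costs $c_1,\ldots,c_n>0$ and probabilities $p_1,\ldots,p_n\in(0,1)$. For $i\in\{2,\ldots,B\}$ let $f_i$ be the $k$-of-$n$ function with $k=\alpha_i$, and let $C(f_i)$ be the minimum expected cost of an adaptive evaluation strategy for $f_i$. Let $\mathsf{OPT}$ be the minimum expected cost of an adaptive evaluation strategy for $f$. Then $C(f_i)\le \mathsf{OPT}$ for all $i\in\{2,\ldots,B\}$.
   Context: A Boolean function is symmetric if its value depends only on the number $N_1(x)$ of ones in $x$; its value vector $R=(R[0],\ldots,R[n])$ has $R[j]$ equal to the value of $f$ on inputs with exactly $j$ ones. A block of $R$ is a maximal contiguous subvector of $R$ whose entries are all equal; $B$ is the number of blocks and $\alpha_1<\cdots<\alpha_B$ are the minimum indices of the blocks. The $k$-of-$n$ function outputs $1$ iff at least $k$ of its $n$ inputs equal $1$. The unknown assignment $x\in\{0,1\}^n$ has independent bits with $\Pr[x_i=1]=p_i$; testing $x_i$ reveals its value at cost $c_i$. An adaptive evaluation strategy for a function $h$ sequentially chooses the next variable to test based on previous outcomes and stops when the outcomes determine $h(x)$; its expected cost is $\sum_x C(x)p(x)$ with $C(x)$ the total cost of tests performed on $x$ and $p(x)=\prod_i p_i^{x_i}(1-p_i)^{1-x_i}$.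
   Formalization: The costs $c_1,\ldots,c_n$ and the probabilities $p_1,\ldots,p_n$ are rational numbers. -}

module Defs where

open import Data.Bool using (Bool; true; false; if_then_else_)
open import Data.Nat using (ℕ; zero; suc; _≤ᵇ_; _<ᵇ_)
open import Data.Fin using (Fin; toℕ)
open import Data.Vec using (Vec; []; _∷_; lookup; tabulate; replicate; _[_]≔_)
open import Data.Maybe using (Maybe; just; nothing)
open import Data.List using (List; []; _∷_; map; _++_; foldr)
open import Data.Product using (Σ; _×_; ∃)
open import Relation.Binary.PropositionalEquality using (_≡_)
open import Relation.Nullary using (¬_)
open import Data.Empty using (⊥)
open import Data.Rational using (ℚ; 0ℚ; 1ℚ; _+_; _*_; _-_)

Assignment : ℕ → Set
Assignment n = Vec Bool n

N₁ : ∀ {n} → Assignment n → ℕ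
N₁ []           = zero
N₁ (true  ∷ xs) = suc (N₁ xs)
N₁ (false ∷ xs) = N₁ xs

Symmetric : ∀ {n} → (Assignment n → Bool) → Set
Symmetric {n} f = ∀ (x y : Assignment n) → N₁ x ≡ N₁ y → f x ≡ f y

onesFirst : (n j : ℕ) → Assignment n
onesFirst n j = tabulate (λ i → toℕ i <ᵇ j)

valueVec : ∀ {n} → (Assignment n → Bool) → ℕ → Bool
valueVec {n} f j = f (onesFirst n j)

-- j is the minimum index of a block of R with j ≠ 0, i.e. j = α_i for some i ≥ 2:
-- 1 ≤ j ≤ n and R[j] differs from R[j-1].
NonFirstBlockStart : ∀ {n} → (Assignment n → Bool) → ℕ → Set
NonFirstBlockStart {n} f zero    = ⊥
NonFirstBlockStart {n} f (suc j) = ((suc j ≤ᵇ n) ≡ true) × ¬ (valueVec f (suc j) ≡ valueVec f j)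

kOfN : (k : ℕ) → ∀ {n} → Assignment n → Bool
kOfN k x = k ≤ᵇ N₁ x

-- Partial knowledge: outcomes of tests performed so far.
Partial : ℕ → Set
Partial n = Vec (Maybe Bool) n

Consistent : ∀ {n} → Partial n → Assignment n → Set
Consistent {n} ρ x = ∀ (i : Fin n) (b : Bool) → lookup ρ i ≡ just b → lookup x i ≡ b

Determined : ∀ {n} → (Assignment n → Bool) → Partial n → Set
Determined {n} h ρ = ∃ λ (b : Bool) → ∀ (x : Assignment n) → Consistent ρ x → h x ≡ b

-- Adaptive strategy as a decision tree: 'stop' or 'test i' then branch on outcome.
data Tree (n : ℕ) : Set where
  stop : Tree n
  test : Fin n → (ifZero ifOne : Tree n) → Tree n

ValidFrom : ∀ {n} → (Assignment n → Bool) → Partial n → Tree n → Set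
ValidFrom h ρ stop           = Determined h ρ
ValidFrom h ρ (test i t₀ t₁) =
  ¬ Determined h ρ × lookup ρ i ≡ nothing
  × ValidFrom h (ρ [ i ]≔ just false) t₀ × ValidFrom h (ρ [ i ]≔ just true) t₁

IsStrategy : ∀ {n} → (Assignment n → Bool) → Tree n → Set
IsStrategy {n} h T = ValidFrom h (replicate n nothing) T

costOn : ∀ {n} → (Fin n → ℚ) → Tree n → Assignment n → ℚ
costOn c stop           x = 0ℚ
costOn c (test i t₀ t₁) x = c i + (if lookup x i then costOn c t₁ x else costOn c t₀ x)

allAssignments : (n : ℕ) → List (Assignment n)
allAssignments zero    = [] ∷ []
allAssignments (suc n) = map (false ∷_) (allAssignments n) ++ map (true ∷_) (allAssignments n)

prob : ∀ {n} → (Fin n → ℚ) → Assignment n → ℚ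
prob {n} p x = go (tabulate (λ i → if lookup x i then p i else 1ℚ - p i))
  where
  go : ∀ {m} → Vec ℚ m → ℚ
  go []       = 1ℚ
  go (q ∷ qs) = q * go qs

expectedCost : ∀ {n} → (Fin n → ℚ) → (Fin n → ℚ) → Tree n → ℚ
expectedCost {n} c p T = foldr (λ x acc → costOn c T x * prob p x + acc) 0ℚ (allAssignments n)

-- Prune a strategy T for f to one for the k-of-n function by stopping as soon as the outcomes
-- seen determine k-of-n, i.e. once k ones are known or fewer than k variables can still be one.
-- Pruning never increases the cost on any input. The pruned tree is valid because every leaf of T
-- determines f, whereas a knowledge state leaving k-of-n open (fewer than k known ones, at least
-- k possible ones) is consistent with inputs having k - 1 and k ones, on which the symmetric f
-- takes the different values R[k - 1] ≠ R[k].
module Submission where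

open import Defs
open import Data.Bool using (Bool; true; false; T)
open import Data.Nat using (ℕ; zero; suc; z≤n; s≤s; _⊓_; _≤?_; _<?_)
import Data.Nat as ℕ
open import Data.Nat.Properties using (≤ᵇ⇒≤; m≤n⇒m⊓n≡m; m≤n⇒m≤1+n; n≤1+n; ≤-refl; ≤-trans; ≤-<-trans; <⇒≤; <⇒≱; ≰⇒>)
open import Data.Fin using (Fin; zero; suc)
open import Data.Product using (∃; _×_; _,_; proj₁; proj₂; map)
open import Data.Rational using (ℚ; 0ℚ; 1ℚ; _<_; _≤_; _+_; _*_; _-_; -_; nonNegative)
open import Data.Rational.Properties using (+-mono-≤; +-monoˡ-≤; +-monoʳ-≤; +-inverseʳ; *-monoʳ-≤-nonNeg; nonNeg*nonNeg⇒nonNeg; nonNegative⁻¹)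
import Data.Rational.Properties as ℚ
open import Data.Vec using (lookup; replicate; _[_]≔_; _∷_; [])
open import Data.Maybe using (just; nothing)
open import Data.List using (List; []; _∷_; foldr)
open import Data.Unit using (tt)
open import Relation.Nullary using (¬_; Dec; yes; no; contradiction)
open import Relation.Nullary.Decidable using (dec-true; dec-false; map′; ¬?; _×-dec_)
open import Relation.Binary.PropositionalEquality using (_≡_; _≢_; refl; sym; trans; subst; cong; module ≡-Reasoning)
open import Function using (_∘_)

knownOnes : ∀ {n} → Partial n → ℕ
knownOnes []               = 0
knownOnes (just true  ∷ ρ) = suc (knownOnes ρ)
knownOnes (just false ∷ ρ) = knownOnes ρ
knownOnes (nothing    ∷ ρ) = knownOnes ρ

possibleOnes : ∀ {n} → Partial n → ℕ
possibleOnes []               = 0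
possibleOnes (just true  ∷ ρ) = suc (possibleOnes ρ)
possibleOnes (just false ∷ ρ) = possibleOnes ρ
possibleOnes (nothing    ∷ ρ) = suc (possibleOnes ρ)

knownOnes≤possibleOnes : ∀ {n} (ρ : Partial n) → knownOnes ρ ℕ.≤ possibleOnes ρ
knownOnes≤possibleOnes []               = z≤n
knownOnes≤possibleOnes (just true  ∷ ρ) = s≤s (knownOnes≤possibleOnes ρ)
knownOnes≤possibleOnes (just false ∷ ρ) = knownOnes≤possibleOnes ρ
knownOnes≤possibleOnes (nothing    ∷ ρ) = m≤n⇒m≤1+n (knownOnes≤possibleOnes ρ)

module _ {n} {ρ : Partial n} {x : Assignment n} where

  consistent-tail : ∀ {m b} → Consistent (m ∷ ρ) (b ∷ x) → Consistent ρ x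
  consistent-tail consistent i = consistent (suc i)

  consistent-head : ∀ {b b′} → Consistent (just b′ ∷ ρ) (b ∷ x) → b ≡ b′
  consistent-head consistent = consistent zero _ refl

  consistent-just∷ : ∀ {b} → Consistent ρ x → Consistent (just b ∷ ρ) (b ∷ x)
  consistent-just∷ consistent zero    _ refl = refl
  consistent-just∷ consistent (suc i)        = consistent i

  consistent-nothing∷ : ∀ {b} → Consistent ρ x → Consistent (nothing ∷ ρ) (b ∷ x)
  consistent-nothing∷ consistent zero    _ ()
  consistent-nothing∷ consistent (suc i)      = consistent i

consistent⇒knownOnes≤N₁ : ∀ {n} (ρ : Partial n) x → Consistent ρ x → knownOnes ρ ℕ.≤ N₁ x
consistent⇒knownOnes≤N₁ []               []          _  = z≤n
consistent⇒knownOnes≤N₁ (just _  ∷ ρ)    (_ ∷ x)     ρx with consistent-head ρx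
consistent⇒knownOnes≤N₁ (just true  ∷ ρ) (true ∷ x)  ρx | refl =
  s≤s (consistent⇒knownOnes≤N₁ ρ x (consistent-tail ρx))
consistent⇒knownOnes≤N₁ (just false ∷ ρ) (false ∷ x) ρx | refl =
  consistent⇒knownOnes≤N₁ ρ x (consistent-tail ρx)
consistent⇒knownOnes≤N₁ (nothing ∷ ρ)    (true ∷ x)  ρx =
  m≤n⇒m≤1+n (consistent⇒knownOnes≤N₁ ρ x (consistent-tail ρx))
consistent⇒knownOnes≤N₁ (nothing ∷ ρ)    (false ∷ x) ρx =
  consistent⇒knownOnes≤N₁ ρ x (consistent-tail ρx)

consistent⇒N₁≤possibleOnes : ∀ {n} (ρ : Partial n) x → Consistent ρ x → N₁ x ℕ.≤ possibleOnes ρ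
consistent⇒N₁≤possibleOnes []               []          _  = z≤n
consistent⇒N₁≤possibleOnes (just _  ∷ ρ)    (_ ∷ x)     ρx with consistent-head ρx
consistent⇒N₁≤possibleOnes (just true  ∷ ρ) (true ∷ x)  ρx | refl =
  s≤s (consistent⇒N₁≤possibleOnes ρ x (consistent-tail ρx))
consistent⇒N₁≤possibleOnes (just false ∷ ρ) (false ∷ x) ρx | refl =
  consistent⇒N₁≤possibleOnes ρ x (consistent-tail ρx)
consistent⇒N₁≤possibleOnes (nothing ∷ ρ)    (true ∷ x)  ρx =
  s≤s (consistent⇒N₁≤possibleOnes ρ x (consistent-tail ρx))
consistent⇒N₁≤possibleOnes (nothing ∷ ρ)    (false ∷ x) ρx =
  m≤n⇒m≤1+n (consistent⇒N₁≤possibleOnes ρ x (consistent-tail ρx))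

consistent-with-N₁ : ∀ {n} (ρ : Partial n) j → knownOnes ρ ℕ.≤ j → j ℕ.≤ possibleOnes ρ
                   → ∃ λ x → Consistent ρ x × N₁ x ≡ j
consistent-with-N₁ []               zero    _         _         = [] , (λ ()) , refl
consistent-with-N₁ (just true  ∷ ρ) (suc j) (s≤s known≤j) (s≤s j≤possible)
  with consistent-with-N₁ ρ j known≤j j≤possible
... | x , ρx , refl = true ∷ x , consistent-just∷ ρx , refl
consistent-with-N₁ (just false ∷ ρ) j known≤j j≤possible
  with consistent-with-N₁ ρ j known≤j j≤possible
... | x , ρx , refl = false ∷ x , consistent-just∷ ρx , refl
consistent-with-N₁ (nothing ∷ ρ) j known≤j _ with j ≤? possibleOnes ρ
... | yes j≤possible with consistent-with-N₁ ρ j known≤j j≤possible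
...   | x , ρx , refl = false ∷ x , consistent-nothing∷ ρx , refl
consistent-with-N₁ (nothing ∷ ρ) zero    _ _                | no j≰possible = contradiction z≤n j≰possible
consistent-with-N₁ (nothing ∷ ρ) (suc j) _ (s≤s j≤possible) | no j+1≰possible
  with consistent-with-N₁ ρ j
         (≤-trans (knownOnes≤possibleOnes ρ) (ℕ.s≤s⁻¹ (≰⇒> j+1≰possible))) j≤possible
... | x , ρx , refl = true ∷ x , consistent-nothing∷ ρx , refl

differentValues⇒¬Determined : ∀ {n} {h : Assignment n → Bool} ρ x y
                            → Consistent ρ x → Consistent ρ y → h x ≢ h y → ¬ Determined h ρ
differentValues⇒¬Determined ρ x y ρx ρy hx≢hy (_ , determines) =
  hx≢hy (trans (determines x ρx) (sym (determines y ρy)))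

Straddles : ∀ {n} → ℕ → Partial n → Set
Straddles k ρ = knownOnes ρ ℕ.< k × k ℕ.≤ possibleOnes ρ

straddles? : ∀ {n} k (ρ : Partial n) → Dec (Straddles k ρ)
straddles? k ρ = knownOnes ρ <? k ×-dec k ≤? possibleOnes ρ

module _ {n : ℕ} (k : ℕ) where

  -- `does (k ≤? m)` computes to `k ≤ᵇ m`, which is how kOfN is defined.
  kOfN-true : (x : Assignment n) → k ℕ.≤ N₁ x → kOfN k x ≡ true
  kOfN-true x = dec-true (k ≤? N₁ x)

  kOfN-false : (x : Assignment n) → N₁ x ℕ.< k → kOfN k x ≡ false
  kOfN-false x N₁x<k = dec-false (k ≤? N₁ x) (<⇒≱ N₁x<k)

  straddles⇒¬kOfN-determined : (ρ : Partial n) → Straddles k ρ → ¬ Determined (kOfN k) ρ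
  straddles⇒¬kOfN-determined ρ (known<k , k≤possible)
    with consistent-with-N₁ ρ (knownOnes ρ) ≤-refl (knownOnes≤possibleOnes ρ)
       | consistent-with-N₁ ρ (possibleOnes ρ) (knownOnes≤possibleOnes ρ) ≤-refl
  ... | x , ρx , N₁x≡known | y , ρy , N₁y≡possible =
    differentValues⇒¬Determined ρ x y ρx ρy λ kx≡ky →
      contradiction (trans (sym (kOfN-false x N₁x<k)) (trans kx≡ky (kOfN-true y k≤N₁y))) λ ()
    where
    N₁x<k : N₁ x ℕ.< k
    N₁x<k = subst (ℕ._< k) (sym N₁x≡known) known<k
    k≤N₁y : k ℕ.≤ N₁ y
    k≤N₁y = subst (k ℕ.≤_) (sym N₁y≡possible) k≤possible

  ¬straddles⇒kOfN-determined : (ρ : Partial n) → ¬ Straddles k ρ → Determined (kOfN k) ρ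
  ¬straddles⇒kOfN-determined ρ ¬straddles with k ≤? knownOnes ρ
  ... | yes k≤known = true , λ x ρx → kOfN-true x (≤-trans k≤known (consistent⇒knownOnes≤N₁ ρ x ρx))
  ... | no  k≰known =
    false , λ x ρx → kOfN-false x (≤-<-trans (consistent⇒N₁≤possibleOnes ρ x ρx) possible<k)
    where
    possible<k : possibleOnes ρ ℕ.< k
    possible<k = ≰⇒> λ k≤possible → ¬straddles (≰⇒> k≰known , k≤possible)

  kOfN-determined? : (ρ : Partial n) → Dec (Determined (kOfN k) ρ)
  kOfN-determined? ρ = map′ (¬straddles⇒kOfN-determined ρ)
                            (λ determined straddles → straddles⇒¬kOfN-determined ρ straddles determined)
                            (¬? (straddles? k ρ))

N₁-onesFirst : ∀ n j → N₁ (onesFirst n j) ≡ j ⊓ n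
N₁-onesFirst zero    zero    = refl
N₁-onesFirst zero    (suc j) = refl
N₁-onesFirst (suc n) zero    = N₁-onesFirst n zero
N₁-onesFirst (suc n) (suc j) = cong suc (N₁-onesFirst n j)

symmetric⇒valueVec : ∀ {n} {f : Assignment n → Bool} → Symmetric f
                   → ∀ x {j} → N₁ x ≡ j → j ℕ.≤ n → f x ≡ valueVec f j
symmetric⇒valueVec {n} symmetric x {j} N₁x≡j j≤n =
  symmetric x (onesFirst n j) (trans N₁x≡j (sym (trans (N₁-onesFirst n j) (m≤n⇒m⊓n≡m j≤n))))

module _ {n} {f : Assignment n → Bool} (symmetric : Symmetric f) where

  blockStart⇒¬straddles : ∀ {k} → NonFirstBlockStart f k → ∀ ρ → Determined f ρ → ¬ Straddles k ρ
  blockStart⇒¬straddles {zero} ()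
  blockStart⇒¬straddles {suc j} (k≤ᵇn , R[j+1]≢R[j]) ρ determined (known<k , k≤possible)
    with consistent-with-N₁ ρ j (ℕ.s≤s⁻¹ known<k) (≤-trans (n≤1+n j) k≤possible)
       | consistent-with-N₁ ρ (suc j) (m≤n⇒m≤1+n (ℕ.s≤s⁻¹ known<k)) k≤possible
  ... | x , ρx , N₁x≡j | y , ρy , N₁y≡k =
    differentValues⇒¬Determined ρ y x ρy ρx (λ fy≡fx → R[j+1]≢R[j] (begin
      valueVec f (suc j) ≡⟨ sym (symmetric⇒valueVec symmetric y N₁y≡k k≤n) ⟩
      f y                ≡⟨ fy≡fx ⟩
      f x                ≡⟨ symmetric⇒valueVec symmetric x N₁x≡j (<⇒≤ k≤n) ⟩
      valueVec f j       ∎)) determined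
    where
    open ≡-Reasoning
    k≤n : suc j ℕ.≤ n
    k≤n = ≤ᵇ⇒≤ (suc j) n (subst T (sym k≤ᵇn) tt)

  blockStart⇒kOfN-determined : ∀ {k} → NonFirstBlockStart f k
                             → ∀ ρ → Determined f ρ → Determined (kOfN k) ρ
  blockStart⇒kOfN-determined {k} blockStart ρ =
    ¬straddles⇒kOfN-determined k ρ ∘ blockStart⇒¬straddles blockStart ρ

module Pruning {n} {h : Assignment n → Bool} (determined? : ∀ ρ → Dec (Determined h ρ)) where

  prune : Partial n → Tree n → Tree n
  prune ρ stop           = stop
  prune ρ (test i t₀ t₁) with determined? ρ
  ... | yes _ = stop
  ... | no  _ = test i (prune (ρ [ i ]≔ just false) t₀) (prune (ρ [ i ]≔ just true) t₁)

  prune-valid : {f : Assignment n → Bool} → (∀ ρ → Determined f ρ → Determined h ρ)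
              → ∀ ρ t → ValidFrom f ρ t → ValidFrom h ρ (prune ρ t)
  prune-valid f⇒h ρ stop           determined = f⇒h ρ determined
  prune-valid f⇒h ρ (test i t₀ t₁) (_ , untested , valid₀ , valid₁) with determined? ρ
  ... | yes determined = determined
  ... | no  undetermined =
    undetermined , untested , prune-valid f⇒h (ρ [ i ]≔ just false) t₀ valid₀
    , prune-valid f⇒h (ρ [ i ]≔ just true) t₁ valid₁

  module _ (c : Fin n → ℚ) (c≥0 : ∀ i → 0ℚ ≤ c i) where

    costOn-nonNeg : ∀ t x → 0ℚ ≤ costOn c t x
    costOn-nonNeg stop           x = ℚ.≤-refl
    costOn-nonNeg (test i t₀ t₁) x with lookup x i
    ... | false = +-mono-≤ (c≥0 i) (costOn-nonNeg t₀ x)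
    ... | true  = +-mono-≤ (c≥0 i) (costOn-nonNeg t₁ x)

    costOn-prune≤ : ∀ ρ t x → costOn c (prune ρ t) x ≤ costOn c t x
    costOn-prune≤ ρ stop           x = ℚ.≤-refl
    costOn-prune≤ ρ (test i t₀ t₁) x with determined? ρ
    ... | yes _ = costOn-nonNeg (test i t₀ t₁) x
    ... | no  _ with lookup x i
    ...   | false = +-monoʳ-≤ (c i) (costOn-prune≤ _ t₀ x)
    ...   | true  = +-monoʳ-≤ (c i) (costOn-prune≤ _ t₁ x)

weightedSum : {A : Set} → (A → ℚ) → (A → ℚ) → List A → ℚ
weightedSum u w = foldr (λ x acc → u x * w x + acc) 0ℚ

weightedSum-monoˡ : {A : Set} {u v w : A → ℚ} → (∀ x → 0ℚ ≤ w x) → (∀ x → u x ≤ v x)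
                  → ∀ xs → weightedSum u w xs ≤ weightedSum v w xs
weightedSum-monoˡ         w≥0 u≤v []       = ℚ.≤-refl
weightedSum-monoˡ {w = w} w≥0 u≤v (x ∷ xs) =
  +-mono-≤ (*-monoʳ-≤-nonNeg (w x) {{nonNegative (w≥0 x)}} (u≤v x)) (weightedSum-monoˡ w≥0 u≤v xs)

*-nonNeg : ∀ {p q} → 0ℚ ≤ p → 0ℚ ≤ q → 0ℚ ≤ p * q
*-nonNeg {p} {q} p≥0 q≥0 =
  nonNegative⁻¹ (p * q) {{nonNeg*nonNeg⇒nonNeg p {{nonNegative p≥0}} q {{nonNegative q≥0}}}}

p≤q⇒0≤q-p : ∀ {p q} → p ≤ q → 0ℚ ≤ q - p
p≤q⇒0≤q-p {p} p≤q = ℚ.≤-trans (ℚ.≤-reflexive (sym (+-inverseʳ p))) (+-monoˡ-≤ (- p) p≤q)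

prob-nonNeg : ∀ {n} (p : Fin n → ℚ) → (∀ i → 0ℚ ≤ p i × p i ≤ 1ℚ) → ∀ x → 0ℚ ≤ prob p x
prob-nonNeg p 0≤p≤1 []          = nonNegative⁻¹ 1ℚ
prob-nonNeg p 0≤p≤1 (true  ∷ x) =
  *-nonNeg (proj₁ (0≤p≤1 zero)) (prob-nonNeg (p ∘ suc) (0≤p≤1 ∘ suc) x)
prob-nonNeg p 0≤p≤1 (false ∷ x) =
  *-nonNeg (p≤q⇒0≤q-p (proj₂ (0≤p≤1 zero))) (prob-nonNeg (p ∘ suc) (0≤p≤1 ∘ suc) x)

expectedCost-mono : ∀ {n} (c p : Fin n → ℚ) (T₁ T₂ : Tree n) → (∀ i → 0ℚ ≤ p i × p i ≤ 1ℚ)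
                  → (∀ x → costOn c T₁ x ≤ costOn c T₂ x) → expectedCost c p T₁ ≤ expectedCost c p T₂
expectedCost-mono {n} c p _ _ 0≤p≤1 cost≤ = weightedSum-monoˡ (prob-nonNeg p 0≤p≤1) cost≤ (allAssignments n)

lemma1 : (n : ℕ) (f : Assignment n → Bool) → Symmetric f
    → (c p : Fin n → ℚ) → (∀ i → 0ℚ < c i) → (∀ i → 0ℚ < p i × p i < 1ℚ)
    → (k : ℕ) → NonFirstBlockStart f k
    → (T : Tree n) → IsStrategy f T
    → ∃ λ (T′ : Tree n) → IsStrategy (kOfN k) T′ × expectedCost c p T′ ≤ expectedCost c p T
lemma1 n f symmetric c p c>0 0<p<1 k blockStart T T-valid =
  prune ρ₀ T , prune-valid (blockStart⇒kOfN-determined symmetric blockStart) ρ₀ T T-valid ,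
  expectedCost-mono c p (prune ρ₀ T) T 0≤p≤1 (costOn-prune≤ c (ℚ.<⇒≤ ∘ c>0) ρ₀ T)
  where
  open Pruning (kOfN-determined? k)
  ρ₀ : Partial n
  ρ₀ = replicate n nothing
  0≤p≤1 : ∀ i → 0ℚ ≤ p i × p i ≤ 1ℚ
  0≤p≤1 i = map ℚ.<⇒≤ ℚ.<⇒≤ (0<p<1 i)
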